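{- Let $G$ be a JIS graph and let $L$ and $L'$ be distinct maximal cliques in $G$. Then: (1) $L$ and $L'$ share at most two vertices. (2) If $L$ and $L'$ share exactly two vertices, then no vertex in $V(L) \setminus V(L')$ is adjacent to a vertex in $V(L') \setminus V(L)$. (3) If $L$ and $L'$ share exactly one vertex, then each vertex in either of the two sets $V(L) \setminus V(L')$ and $V(L') \setminus V(L)$ is adjacent to at most one vertex in the other set.
   Context: All graphs are finite and simple. A clique is a complete subgraph; a maximal clique is a clique not contained in any larger clique. A graph $G$ is called JIS if there exist a positive integer $n$ and an assignment of an $n$-element set $S_v$ to each vertex $v$ of $G$ such that distinct vertices receive distinct sets, and for distinct vertices $v,w$, $v$ and $w$ are adjacent iff $|S_v \cap S_w| = n-1$ (equivalently, $G$ is isomorphic to an induced subgraph of a Johnson graph). -}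

module Defs where

open import Data.Nat using (ℕ; _≤_; _∸_)
open import Data.Fin using (Fin)
open import Data.Fin.Subset using (Subset; _∈_; _∉_; _⊆_; _∩_; ∣_∣)
open import Data.Product using (Σ; ∃; _×_)
open import Relation.Binary.PropositionalEquality using (_≡_; _≢_)
open import Relation.Nullary using (¬_)

record Graph (N : ℕ) : Set₁ where
  field
    Adj    : Fin N → Fin N → Set
    sym    : ∀ {v w} → Adj v w → Adj w v
    irrefl : ∀ {v} → ¬ Adj v v
open Graph public

IsClique : ∀ {N} → Graph N → Subset N → Set
IsClique G K = ∀ v w → v ∈ K → w ∈ K → v ≢ w → Adj G v w

IsMaximalClique : ∀ {N} → Graph N → Subset N → Set
IsMaximalClique G K = IsClique G K × (∀ K′ → IsClique G K′ → K ⊆ K′ → K′ ≡ K)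

IsJIS : ∀ {N} → Graph N → Set
IsJIS {N} G =
  Σ ℕ λ n → (1 ≤ n) × (Σ ℕ λ m → Σ (Fin N → Subset m) λ S →
      (∀ v → ∣ S v ∣ ≡ n)
    × (∀ v w → S v ≡ S w → v ≡ w)
    × (∀ v w → v ≢ w →
         (Adj G v w → ∣ S v ∩ S w ∣ ≡ n ∸ 1)
       × (∣ S v ∩ S w ∣ ≡ n ∸ 1 → Adj G v w)))

module Submission where

-- Write S_v for the (n+1)-sets representing the vertices, so that adjacency
-- means sharing exactly n points.  The geometric heart of the proof is the
-- triangle lemma: if a, b, c are pairwise adjacent and x, y are each equal or
-- adjacent to all three, then x and y are equal or adjacent.  Indeed a
-- triangle either forms a "star" (S_c contains I = S_a ∩ S_b) or a "top"
-- (S_c ⊆ U = S_a ∪ S_b); in the first case every such x contains I, in the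
-- second every such x lies inside U, and in both cases two such sets share at
-- least n points.

open import Defs
open import Data.Nat using (ℕ; _≤_)
open import Data.Fin using (Fin)
open import Data.Fin.Subset using (Subset; _∈_; _∉_; _∩_; ∣_∣)
open import Data.Product using (_×_)
open import Relation.Binary.PropositionalEquality using (_≡_; _≢_)
open import Relation.Nullary using (¬_)

open import Data.Nat using (zero; suc; _+_; _<_; _≤ᵇ_; z≤n; s≤s; _≤?_)
open import Data.Nat.Properties
  using (≤-trans; ≤-reflexive; ≤-antisym; ≤-pred; ≤-<-trans; ≰⇒>; <-irrefl; n≤1+n; m≤n+m;
         n≤0⇒n≡0; m≤n⇒m<n∨m≡n; ≤ᵇ⇒≤; suc-injective; +-suc; +-mono-≤; +-monoˡ-≤; +-monoʳ-<;
         +-cancelˡ-≤; +-cancelʳ-≤; +-cancelʳ-<; +-commutativeSemigroup; module ≤-Reasoning)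
open import Data.Nat.Tactic.RingSolver using (solve-∀)
open import Algebra.Properties.CommutativeSemigroup +-commutativeSemigroup using (interchange)
open import Data.Bool using (Bool; true; false; _∧_; _∨_; T)
open import Data.Bool.Properties using (T-∧)
open import Data.Fin using (zero; suc)
open import Data.Fin.Properties using (_≟_)
open import Data.Fin.Subset using (_∪_; ⁅_⁆; ⊥; _⊆_)
open import Data.Fin.Subset.Properties
  using (∣p∣≤n; ∣p∣≤∣x∷p∣; ∣p∩q∣≤∣p∣; ∩-idem; ∩-comm; ⊆-antisym; p⊆p∪q; x∈p∪q⁺; x∈p∪q⁻; x∈p∩q⁻;
         x∈⁅x⁆; x∈⁅y⁆⇒x≡y; ∣⁅x⁆∣≡1; ∣⊥∣≡0)
open import Data.Vec using (Vec; []; _∷_; lookup; map; head; tail)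
open import Data.Vec.Base using (here; there)
open import Data.Product using (_,_; proj₁; proj₂; ∃; ∃₂)
open import Data.Sum using (_⊎_; inj₁; inj₂)
open import Data.Empty using (⊥-elim)
open import Function using (_∘_)
open import Function.Bundles using (Equivalence)
open import Relation.Nullary using (yes; no)
open import Relation.Binary.PropositionalEquality
  using (refl; trans; cong; cong₂; subst; subst₂)
import Relation.Binary.PropositionalEquality as ≡

-- 1. Counting by Venn diagrams

infixr 7 _∩ᵗ_
infixr 6 _∪ᵗ_
data Term (k : ℕ) : Set where
  var       : Fin k → Term k
  _∩ᵗ_ _∪ᵗ_ : Term k → Term k → Term k

infixl 5 _+ᶜ_
data Count (k : ℕ) : Set where
  ∣_∣ᶜ : Term k → Count k
  _+ᶜ_ : Count k → Count k → Count k

⟦_⟧ : ∀ {k m} → Term k → Vec (Subset m) k → Subset m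
⟦ var i ⟧  ss = lookup ss i
⟦ s ∩ᵗ t ⟧ ss = ⟦ s ⟧ ss ∩ ⟦ t ⟧ ss
⟦ s ∪ᵗ t ⟧ ss = ⟦ s ⟧ ss ∪ ⟦ t ⟧ ss

⟦_⟧ᵇ : ∀ {k} → Term k → Vec Bool k → Bool
⟦ var i ⟧ᵇ  bs = lookup bs i
⟦ s ∩ᵗ t ⟧ᵇ bs = ⟦ s ⟧ᵇ bs ∧ ⟦ t ⟧ᵇ bs
⟦ s ∪ᵗ t ⟧ᵇ bs = ⟦ s ⟧ᵇ bs ∨ ⟦ t ⟧ᵇ bs

bit : Bool → ℕ
bit true  = 1
bit false = 0

size : ∀ {k m} → Count k → Vec (Subset m) k → ℕ
size ∣ t ∣ᶜ     ss = ∣ ⟦ t ⟧ ss ∣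
size (c +ᶜ d) ss = size c ss + size d ss

bits : ∀ {k} → Count k → Vec Bool k → ℕ
bits ∣ t ∣ᶜ     bs = bit (⟦ t ⟧ᵇ bs)
bits (c +ᶜ d) bs = bits c bs + bits d bs

heads : ∀ {k m} → Vec (Subset (suc m)) k → Vec Bool k
heads = map head

tails : ∀ {k m} → Vec (Subset (suc m)) k → Vec (Subset m) k
tails = map tail

lookup-split : ∀ {k m} (ss : Vec (Subset (suc m)) k) i →
  lookup ss i ≡ lookup (heads ss) i ∷ lookup (tails ss) i
lookup-split ((_ ∷ _) ∷ _) zero    = refl
lookup-split (_ ∷ ss)      (suc i) = lookup-split ss i

⟦⟧-split : ∀ {k m} (t : Term k) (ss : Vec (Subset (suc m)) k) →
  ⟦ t ⟧ ss ≡ ⟦ t ⟧ᵇ (heads ss) ∷ ⟦ t ⟧ (tails ss)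
⟦⟧-split (var i)  ss = lookup-split ss i
⟦⟧-split (s ∩ᵗ t) ss rewrite ⟦⟧-split s ss | ⟦⟧-split t ss = refl
⟦⟧-split (s ∪ᵗ t) ss rewrite ⟦⟧-split s ss | ⟦⟧-split t ss = refl

∣∷∣ : ∀ {m} b (p : Subset m) → ∣ b ∷ p ∣ ≡ bit b + ∣ p ∣
∣∷∣ true  p = refl
∣∷∣ false p = refl

size-split : ∀ {k m} (c : Count k) (ss : Vec (Subset (suc m)) k) →
  size c ss ≡ bits c (heads ss) + size c (tails ss)
size-split ∣ t ∣ᶜ     ss rewrite ⟦⟧-split t ss = ∣∷∣ (⟦ t ⟧ᵇ (heads ss)) (⟦ t ⟧ (tails ss))
size-split (c +ᶜ d) ss rewrite size-split c ss | size-split d ss =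
  interchange (bits c (heads ss)) (size c (tails ss)) (bits d (heads ss)) (size d (tails ss))

size-empty : ∀ {k} (c : Count k) (ss : Vec (Subset 0) k) → size c ss ≡ 0
size-empty ∣ t ∣ᶜ     ss = n≤0⇒n≡0 (∣p∣≤n (⟦ t ⟧ ss))
size-empty (c +ᶜ d) ss rewrite size-empty c ss | size-empty d ss = refl

venn-pointwise : ∀ {k} (c d : Count k) → (∀ bs → bits c bs ≤ bits d bs) →
  ∀ {m} (ss : Vec (Subset m) k) → size c ss ≤ size d ss
venn-pointwise c d pointwise {zero} ss rewrite size-empty c ss = z≤n
venn-pointwise c d pointwise {suc m} ss rewrite size-split c ss | size-split d ss =
  +-mono-≤ (pointwise (heads ss)) (venn-pointwise c d pointwise (tails ss))

allBits : ∀ k → (Vec Bool k → Bool) → Bool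
allBits zero    f = f []
allBits (suc k) f = allBits k (f ∘ (true ∷_)) ∧ allBits k (f ∘ (false ∷_))

allBits-sound : ∀ k f → T (allBits k f) → ∀ bs → T (f bs)
allBits-sound zero    f ok []           = ok
allBits-sound (suc k) f ok (true ∷ bs)  = allBits-sound k _ (proj₁ (Equivalence.to T-∧ ok)) bs
allBits-sound (suc k) f ok (false ∷ bs) = allBits-sound k _ (proj₂ (Equivalence.to T-∧ ok)) bs

-- The decision procedure: the point-wise check is discharged by evaluation.
venn : ∀ {k} (c d : Count k) {_ : T (allBits k (λ bs → bits c bs ≤ᵇ bits d bs))} →
  ∀ {m} (ss : Vec (Subset m) k) → size c ss ≤ size d ss
venn {k} c d {ok} = venn-pointwise c d (λ bs → ≤ᵇ⇒≤ _ _ (allBits-sound k _ ok bs))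

module Variables where
  V₀ : ∀ {k} → Term (1 + k)
  V₁ : ∀ {k} → Term (2 + k)
  V₂ : ∀ {k} → Term (3 + k)
  V₃ : ∀ {k} → Term (4 + k)
  V₀ = var zero
  V₁ = var (suc zero)
  V₂ = var (suc (suc zero))
  V₃ = var (suc (suc (suc zero)))

open Variables

union-bound : ∀ {m} (p q : Subset m) → ∣ p ∪ q ∣ ≤ ∣ p ∣ + ∣ q ∣
union-bound p q = venn ∣ V₀ ∪ᵗ V₁ ∣ᶜ (∣ V₀ ∣ᶜ +ᶜ ∣ V₁ ∣ᶜ) (p ∷ q ∷ [])

union-size : ∀ {m} (a b : Subset m) → ∣ a ∪ b ∣ + ∣ a ∩ b ∣ ≤ ∣ a ∣ + ∣ b ∣
union-size a b = venn (∣ V₀ ∪ᵗ V₁ ∣ᶜ +ᶜ ∣ V₀ ∩ᵗ V₁ ∣ᶜ) (∣ V₀ ∣ᶜ +ᶜ ∣ V₁ ∣ᶜ) (a ∷ b ∷ [])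

-- Inclusion–exclusion inside c: the parts of c in a and in b are covered by
-- the part of c in a ∪ b, counted once, and the part in a ∩ b, counted again.
split-count : ∀ {m} (a b c : Subset m) →
  ∣ a ∩ c ∣ + ∣ b ∩ c ∣ ≤ ∣ c ∩ (a ∪ b) ∣ + ∣ c ∩ (a ∩ b) ∣
split-count a b c = venn
  (∣ V₀ ∩ᵗ V₂ ∣ᶜ +ᶜ ∣ V₁ ∩ᵗ V₂ ∣ᶜ)
  (∣ V₂ ∩ᵗ (V₀ ∪ᵗ V₁) ∣ᶜ +ᶜ ∣ V₂ ∩ᵗ (V₀ ∩ᵗ V₁) ∣ᶜ)
  (a ∷ b ∷ c ∷ [])

overlap-count : ∀ {m} (x y w : Subset m) → ∣ x ∩ w ∣ + ∣ y ∩ w ∣ ≤ ∣ w ∣ + ∣ x ∩ y ∣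
overlap-count x y w = venn
  (∣ V₀ ∩ᵗ V₂ ∣ᶜ +ᶜ ∣ V₁ ∩ᵗ V₂ ∣ᶜ) (∣ V₂ ∣ᶜ +ᶜ ∣ V₀ ∩ᵗ V₁ ∣ᶜ) (x ∷ y ∷ w ∷ [])

-- The star estimate: if c ∩ (a ∩ b) is large, a set x meeting a, b and c in
-- many points must meet a ∩ b in many points.
star-count : ∀ {m} (x a b c : Subset m) →
  ∣ x ∩ a ∣ + ∣ x ∩ b ∣ + ∣ x ∩ c ∣ + ∣ c ∩ (a ∩ b) ∣ + ∣ c ∩ (a ∩ b) ∣
    ≤ ∣ x ∣ + ∣ x ∩ (a ∩ b) ∣ + ∣ x ∩ (a ∩ b) ∣ + ∣ a ∩ c ∣ + ∣ b ∩ c ∣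
star-count x a b c = venn
  (∣ V₀ ∩ᵗ V₁ ∣ᶜ +ᶜ ∣ V₀ ∩ᵗ V₂ ∣ᶜ +ᶜ ∣ V₀ ∩ᵗ V₃ ∣ᶜ
     +ᶜ ∣ V₃ ∩ᵗ (V₁ ∩ᵗ V₂) ∣ᶜ +ᶜ ∣ V₃ ∩ᵗ (V₁ ∩ᵗ V₂) ∣ᶜ)
  (∣ V₀ ∣ᶜ +ᶜ ∣ V₀ ∩ᵗ (V₁ ∩ᵗ V₂) ∣ᶜ +ᶜ ∣ V₀ ∩ᵗ (V₁ ∩ᵗ V₂) ∣ᶜ
     +ᶜ ∣ V₁ ∩ᵗ V₃ ∣ᶜ +ᶜ ∣ V₂ ∩ᵗ V₃ ∣ᶜ)
  (x ∷ a ∷ b ∷ c ∷ [])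

-- The top estimate, dual to the star estimate: if c ∩ (a ∪ b) is large, a
-- set x meeting a, b and c in many points must meet a ∪ b in many points.
top-count : ∀ {m} (x a b c : Subset m) →
  ∣ x ∩ a ∣ + ∣ x ∩ b ∣ + ∣ x ∩ c ∣ + ∣ c ∩ (a ∪ b) ∣ + ∣ c ∩ (a ∪ b) ∣
    ≤ ∣ c ∣ + ∣ x ∩ (a ∪ b) ∣ + ∣ x ∩ (a ∪ b) ∣ + ∣ a ∩ c ∣ + ∣ b ∩ c ∣
top-count x a b c = venn
  (∣ V₀ ∩ᵗ V₁ ∣ᶜ +ᶜ ∣ V₀ ∩ᵗ V₂ ∣ᶜ +ᶜ ∣ V₀ ∩ᵗ V₃ ∣ᶜ
     +ᶜ ∣ V₃ ∩ᵗ (V₁ ∪ᵗ V₂) ∣ᶜ +ᶜ ∣ V₃ ∩ᵗ (V₁ ∪ᵗ V₂) ∣ᶜ)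
  (∣ V₃ ∣ᶜ +ᶜ ∣ V₀ ∩ᵗ (V₁ ∪ᵗ V₂) ∣ᶜ +ᶜ ∣ V₀ ∩ᵗ (V₁ ∪ᵗ V₂) ∣ᶜ
     +ᶜ ∣ V₁ ∩ᵗ V₃ ∣ᶜ +ᶜ ∣ V₂ ∩ᵗ V₃ ∣ᶜ)
  (x ∷ a ∷ b ∷ c ∷ [])

-- 2. Triangles of (n+1)-sets

halve : ∀ k j → k + k ≤ suc (j + j) → k ≤ j
halve zero    j       _       = z≤n
halve (suc k) zero    (s≤s h) with ≤-trans (m≤n+m (suc k) k) h
... | ()
halve (suc k) (suc j) (s≤s h) rewrite +-suc k k | +-suc j j = s≤s (halve k j (≤-pred h))

-- The arithmetic shape shared by the star and the top estimate.
five-bound : ∀ n k j → n + n + n + k + k ≤ suc n + j + j + n + n → k ≤ j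
five-bound n k j h = halve k j (+-cancelˡ-≤ (n + n + n) _ _ (subst₂ _≤_ (lhs n k) (rhs n j) h))
  where
  lhs : ∀ n k → n + n + n + k + k ≡ n + n + n + (k + k)
  lhs = solve-∀
  rhs : ∀ n j → suc n + j + j + n + n ≡ n + n + n + suc (j + j)
  rhs = solve-∀

split-sum : ∀ n u i → n + n ≤ u + i → n ≤ i ⊎ suc n ≤ u
split-sum n u i h with n ≤? i
... | yes n≤i = inj₁ n≤i
... | no  n≰i = inj₂ (+-cancelʳ-< n n u (≤-<-trans h (+-monoʳ-< u (≰⇒> n≰i))))

module Triangle {m} (n : ℕ) (a b c : Subset m)
  (∣a∣ : ∣ a ∣ ≡ suc n) (∣b∣ : ∣ b ∣ ≡ suc n) (∣c∣ : ∣ c ∣ ≡ suc n)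
  (∣a∩b∣ : ∣ a ∩ b ∣ ≡ n) (∣a∩c∣ : ∣ a ∩ c ∣ ≡ n) (∣b∩c∣ : ∣ b ∩ c ∣ ≡ n) where

  record Close (x : Subset m) : Set where
    field
      size-x  : ∣ x ∣ ≡ suc n
      meets-a : n ≤ ∣ x ∩ a ∣
      meets-b : n ≤ ∣ x ∩ b ∣
      meets-c : n ≤ ∣ x ∩ c ∣
  open Close

  meets-three : ∀ {x} → Close x → n + n + n ≤ ∣ x ∩ a ∣ + ∣ x ∩ b ∣ + ∣ x ∩ c ∣
  meets-three cx = +-mono-≤ (+-mono-≤ (meets-a cx) (meets-b cx)) (meets-c cx)

  star : n ≤ ∣ c ∩ (a ∩ b) ∣ → ∀ {x} → Close x → n ≤ ∣ x ∩ (a ∩ b) ∣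
  star n≤∣c∩I∣ {x} cx = five-bound n n ∣ x ∩ (a ∩ b) ∣ (begin
    n + n + n + n + n
      ≤⟨ +-mono-≤ (+-mono-≤ (meets-three cx) n≤∣c∩I∣) n≤∣c∩I∣ ⟩
    ∣ x ∩ a ∣ + ∣ x ∩ b ∣ + ∣ x ∩ c ∣ + ∣ c ∩ (a ∩ b) ∣ + ∣ c ∩ (a ∩ b) ∣
      ≤⟨ star-count x a b c ⟩
    ∣ x ∣ + ∣ x ∩ (a ∩ b) ∣ + ∣ x ∩ (a ∩ b) ∣ + ∣ a ∩ c ∣ + ∣ b ∩ c ∣
      ≡⟨ known-sizes ⟩
    suc n + ∣ x ∩ (a ∩ b) ∣ + ∣ x ∩ (a ∩ b) ∣ + n + n ∎)
    where
    open ≤-Reasoning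
    known-sizes : ∣ x ∣ + ∣ x ∩ (a ∩ b) ∣ + ∣ x ∩ (a ∩ b) ∣ + ∣ a ∩ c ∣ + ∣ b ∩ c ∣
                ≡ suc n + ∣ x ∩ (a ∩ b) ∣ + ∣ x ∩ (a ∩ b) ∣ + n + n
    known-sizes = trans (cong (λ s → s + i + i + ∣ a ∩ c ∣ + ∣ b ∩ c ∣) (size-x cx))
                        (cong₂ (λ p q → suc n + i + i + p + q) ∣a∩c∣ ∣b∩c∣)
      where i : ℕ
            i = ∣ x ∩ (a ∩ b) ∣

  top : suc n ≤ ∣ c ∩ (a ∪ b) ∣ → ∀ {x} → Close x → suc n ≤ ∣ x ∩ (a ∪ b) ∣
  top n<∣c∩U∣ {x} cx = five-bound n (suc n) ∣ x ∩ (a ∪ b) ∣ (begin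
    n + n + n + suc n + suc n
      ≤⟨ +-mono-≤ (+-mono-≤ (meets-three cx) n<∣c∩U∣) n<∣c∩U∣ ⟩
    ∣ x ∩ a ∣ + ∣ x ∩ b ∣ + ∣ x ∩ c ∣ + ∣ c ∩ (a ∪ b) ∣ + ∣ c ∩ (a ∪ b) ∣
      ≤⟨ top-count x a b c ⟩
    ∣ c ∣ + ∣ x ∩ (a ∪ b) ∣ + ∣ x ∩ (a ∪ b) ∣ + ∣ a ∩ c ∣ + ∣ b ∩ c ∣
      ≡⟨ known-sizes ⟩
    suc n + ∣ x ∩ (a ∪ b) ∣ + ∣ x ∩ (a ∪ b) ∣ + n + n ∎)
    where
    open ≤-Reasoning
    known-sizes : ∣ c ∣ + ∣ x ∩ (a ∪ b) ∣ + ∣ x ∩ (a ∪ b) ∣ + ∣ a ∩ c ∣ + ∣ b ∩ c ∣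
                ≡ suc n + ∣ x ∩ (a ∪ b) ∣ + ∣ x ∩ (a ∪ b) ∣ + n + n
    known-sizes = trans (cong (λ s → s + u + u + ∣ a ∩ c ∣ + ∣ b ∩ c ∣) ∣c∣)
                        (cong₂ (λ p q → suc n + u + u + p + q) ∣a∩c∣ ∣b∩c∣)
      where u : ℕ
            u = ∣ x ∩ (a ∪ b) ∣

  star-or-top : n ≤ ∣ c ∩ (a ∩ b) ∣ ⊎ suc n ≤ ∣ c ∩ (a ∪ b) ∣
  star-or-top = split-sum n _ _
    (subst (_≤ ∣ c ∩ (a ∪ b) ∣ + ∣ c ∩ (a ∩ b) ∣) (cong₂ _+_ ∣a∩c∣ ∣b∩c∣) (split-count a b c))

  close⇒overlap : ∀ {x y} → Close x → Close y → n ≤ ∣ x ∩ y ∣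
  close⇒overlap {x} {y} cx cy with star-or-top
  ... | inj₁ is-star = +-cancelˡ-≤ n _ _ (begin
    n + n                       ≤⟨ +-mono-≤ (star is-star cx) (star is-star cy) ⟩
    ∣ x ∩ (a ∩ b) ∣ + ∣ y ∩ (a ∩ b) ∣ ≤⟨ overlap-count x y (a ∩ b) ⟩
    ∣ a ∩ b ∣ + ∣ x ∩ y ∣         ≡⟨ cong (_+ ∣ x ∩ y ∣) ∣a∩b∣ ⟩
    n + ∣ x ∩ y ∣                 ∎)
    where open ≤-Reasoning
  ... | inj₂ is-top = +-cancelˡ-≤ (suc (suc n)) _ _ (begin
    suc (suc n) + n             ≡⟨ ≡.sym (+-suc (suc n) n) ⟩
    suc n + suc n               ≤⟨ +-mono-≤ (top is-top cx) (top is-top cy) ⟩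
    ∣ x ∩ (a ∪ b) ∣ + ∣ y ∩ (a ∪ b) ∣ ≤⟨ overlap-count x y (a ∪ b) ⟩
    ∣ a ∪ b ∣ + ∣ x ∩ y ∣         ≤⟨ +-monoˡ-≤ ∣ x ∩ y ∣ ∣a∪b∣≤n+2 ⟩
    suc (suc n) + ∣ x ∩ y ∣       ∎)
    where
    open ≤-Reasoning
    ∣a∪b∣≤n+2 : ∣ a ∪ b ∣ ≤ suc (suc n)
    ∣a∪b∣≤n+2 = +-cancelʳ-≤ n _ _ (begin
      ∣ a ∪ b ∣ + n           ≡⟨ cong (∣ a ∪ b ∣ +_) (≡.sym ∣a∩b∣) ⟩
      ∣ a ∪ b ∣ + ∣ a ∩ b ∣   ≤⟨ union-size a b ⟩
      ∣ a ∣ + ∣ b ∣           ≡⟨ cong₂ _+_ ∣a∣ ∣b∣ ⟩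
      suc n + suc n           ≡⟨ +-suc (suc n) n ⟩
      suc (suc n) + n         ∎)

∣p∩q∣≡∣p∣⇒p∩q≡p : ∀ {m} (p q : Subset m) → ∣ p ∩ q ∣ ≡ ∣ p ∣ → p ∩ q ≡ p
∣p∩q∣≡∣p∣⇒p∩q≡p []          []          _ = refl
∣p∩q∣≡∣p∣⇒p∩q≡p (true ∷ p)  (true ∷ q)  h = cong (true ∷_) (∣p∩q∣≡∣p∣⇒p∩q≡p p q (suc-injective h))
∣p∩q∣≡∣p∣⇒p∩q≡p (true ∷ p)  (false ∷ q) h =
  ⊥-elim (<-irrefl h (s≤s (∣p∩q∣≤∣p∣ p q)))
∣p∩q∣≡∣p∣⇒p∩q≡p (false ∷ p) (_ ∷ q)     h = cong (false ∷_) (∣p∩q∣≡∣p∣⇒p∩q≡p p q h)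

-- Two sets of the same size that overlap completely coincide; this is why
-- distinct vertices of a JIS graph share at most n of their n+1 points.
full-overlap⇒≡ : ∀ {m} (p q : Subset m) → ∣ p ∣ ≡ ∣ q ∣ → ∣ p ∩ q ∣ ≡ ∣ p ∣ → p ≡ q
full-overlap⇒≡ p q ∣p∣≡∣q∣ full = begin
  p       ≡⟨ ≡.sym (∣p∩q∣≡∣p∣⇒p∩q≡p p q full) ⟩
  p ∩ q   ≡⟨ ∩-comm p q ⟩
  q ∩ p   ≡⟨ ∣p∩q∣≡∣p∣⇒p∩q≡p q p (trans (cong ∣_∣ (∩-comm q p)) (trans full ∣p∣≡∣q∣)) ⟩
  q       ∎
  where open ≡.≡-Reasoning

-- 3. JIS graphs are triangle-closed

module _ {N : ℕ} (G : Graph N) where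

  Near : Fin N → Fin N → Set
  Near v w = v ≡ w ⊎ Adj G v w

  NearAll : Fin N → Fin N → Fin N → Fin N → Set
  NearAll x a b c = Near x a × Near x b × Near x c

  TriangleClosed : Set
  TriangleClosed = ∀ {a b c x y} → Adj G a b → Adj G a c → Adj G b c →
    NearAll x a b c → NearAll y a b c → Near x y

  adj⇒≢ : ∀ {v w} → Adj G v w → v ≢ w
  adj⇒≢ adj refl = irrefl G adj

module JohnsonModel {N : ℕ} (G : Graph N) (n m : ℕ) (S : Fin N → Subset m)
  (uniform   : ∀ v → ∣ S v ∣ ≡ suc n)
  (injective : ∀ v w → S v ≡ S w → v ≡ w)
  (adjacency : ∀ v w → v ≢ w →
                 (Adj G v w → ∣ S v ∩ S w ∣ ≡ n) × (∣ S v ∩ S w ∣ ≡ n → Adj G v w)) where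

  adj⇒overlap : ∀ {v w} → Adj G v w → ∣ S v ∩ S w ∣ ≡ n
  adj⇒overlap {v} {w} adj = proj₁ (adjacency v w (adj⇒≢ G adj)) adj

  near⇒overlap : ∀ {v w} → Near G v w → n ≤ ∣ S v ∩ S w ∣
  near⇒overlap {v} (inj₁ refl) =
    subst (n ≤_) (≡.sym (trans (cong ∣_∣ (∩-idem (S v))) (uniform v))) (n≤1+n n)
  near⇒overlap (inj₂ adj) = ≤-reflexive (≡.sym (adj⇒overlap adj))

  overlap⇒near : ∀ v w → n ≤ ∣ S v ∩ S w ∣ → Near G v w
  overlap⇒near v w n≤ with v ≟ w
  ... | yes v≡w = inj₁ v≡w
  ... | no  v≢w with m≤n⇒m<n∨m≡n (subst (∣ S v ∩ S w ∣ ≤_) (uniform v) (∣p∩q∣≤∣p∣ (S v) (S w)))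
  ...   | inj₁ <n+1 = inj₂ (proj₂ (adjacency v w v≢w) (≤-antisym (≤-pred <n+1) n≤))
  ...   | inj₂ ≡n+1 = ⊥-elim (v≢w (injective v w (full-overlap⇒≡ (S v) (S w)
                          (trans (uniform v) (≡.sym (uniform w))) (trans ≡n+1 (≡.sym (uniform v))))))

  triangle-closed : TriangleClosed G
  triangle-closed {a} {b} {c} {x} {y} ab ac bc near-x near-y =
    overlap⇒near x y (close⇒overlap (close near-x) (close near-y))
    where
    open Triangle n (S a) (S b) (S c) (uniform a) (uniform b) (uniform c)
      (adj⇒overlap ab) (adj⇒overlap ac) (adj⇒overlap bc)
    close : ∀ {z} → NearAll G z a b c → Close (S z)
    close {z} (za , zb , zc) = record
      { size-x = uniform z ; meets-a = near⇒overlap za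
      ; meets-b = near⇒overlap zb ; meets-c = near⇒overlap zc }

jis⇒triangle-closed : ∀ {N} (G : Graph N) → IsJIS G → TriangleClosed G
jis⇒triangle-closed G (zero  , () , _)
jis⇒triangle-closed G (suc n , _ , m , S , uniform , injective , adjacency) =
  JohnsonModel.triangle-closed G n m S uniform injective adjacency

-- 4. Maximal cliques of triangle-closed graphs

there-∈-∉ : ∀ {m} {p q : Subset m} {s t} →
  (∃ λ z → z ∈ p × z ∉ q) → ∃ λ z → z ∈ s ∷ p × z ∉ t ∷ q
there-∈-∉ (z , z∈p , z∉q) = suc z , there z∈p , λ { (there z∈q) → z∉q z∈q }

∃-∈-∉ : ∀ {m} (p q : Subset m) → ∣ q ∣ < ∣ p ∣ → ∃ λ z → z ∈ p × z ∉ q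
∃-∈-∉ []          []          ()
∃-∈-∉ (true ∷ p)  (false ∷ q) _       = zero , here , λ ()
∃-∈-∉ (true ∷ p)  (true ∷ q)  (s≤s h) = there-∈-∉ (∃-∈-∉ p q h)
∃-∈-∉ (false ∷ p) (s ∷ q)     h       =
  there-∈-∉ (∃-∈-∉ p q (≤-trans (s≤s (∣p∣≤∣x∷p∣ s q)) h))

∈∉⇒≢ : ∀ {m} {p : Subset m} {v w} → v ∈ p → w ∉ p → v ≢ w
∈∉⇒≢ v∈p w∉p refl = w∉p v∈p

some-member : ∀ {m} (p : Subset m) → 1 ≤ ∣ p ∣ → ∃ λ a → a ∈ p
some-member {m} p h with ∃-∈-∉ p ⊥ (subst (_< ∣ p ∣) (≡.sym (∣⊥∣≡0 m)) h)
... | a , a∈p , _ = a , a∈p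

two-members : ∀ {m} (p : Subset m) → 2 ≤ ∣ p ∣ → ∃₂ λ a b → a ∈ p × b ∈ p × a ≢ b
two-members p h with some-member p (≤-trans (s≤s z≤n) h)
... | a , a∈p with ∃-∈-∉ p ⁅ a ⁆ (subst (_< ∣ p ∣) (≡.sym (∣⁅x⁆∣≡1 a)) h)
...   | b , b∈p , b∉⁅a⁆ = a , b , a∈p , b∈p , λ { refl → b∉⁅a⁆ (x∈⁅x⁆ a) }

∣⁅a⁆∪⁅b⁆∣≤2 : ∀ {m} (a b : Fin m) → ∣ ⁅ a ⁆ ∪ ⁅ b ⁆ ∣ ≤ 2
∣⁅a⁆∪⁅b⁆∣≤2 a b = subst (∣ ⁅ a ⁆ ∪ ⁅ b ⁆ ∣ ≤_) (cong₂ _+_ (∣⁅x⁆∣≡1 a) (∣⁅x⁆∣≡1 b)) (union-bound ⁅ a ⁆ ⁅ b ⁆)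

three-members : ∀ {m} (p : Subset m) → 3 ≤ ∣ p ∣ →
  ∃₂ λ a b → ∃ λ c → a ∈ p × b ∈ p × c ∈ p × a ≢ b × a ≢ c × b ≢ c
three-members p h with two-members p (≤-trans (s≤s (s≤s z≤n)) h)
... | a , b , a∈p , b∈p , a≢b with ∃-∈-∉ p (⁅ a ⁆ ∪ ⁅ b ⁆) (≤-<-trans (∣⁅a⁆∪⁅b⁆∣≤2 a b) h)
...   | c , c∈p , c∉ab = a , b , c , a∈p , b∈p , c∈p , a≢b
        , (λ { refl → c∉ab (x∈p∪q⁺ (inj₁ (x∈⁅x⁆ a))) })
        , (λ { refl → c∉ab (x∈p∪q⁺ (inj₂ (x∈⁅x⁆ b))) })

module MaximalCliques {N : ℕ} (G : Graph N) (closed : TriangleClosed G) where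

  clique-near : ∀ {L v w} → IsClique G L → v ∈ L → w ∈ L → Near G v w
  clique-near {v = v} {w} clique v∈L w∈L with v ≟ w
  ... | yes v≡w = inj₁ v≡w
  ... | no  v≢w = inj₂ (clique v w v∈L w∈L v≢w)

  near-adj : ∀ {v w} → Near G v w → v ≢ w → Adj G v w
  near-adj (inj₁ v≡w) v≢w = ⊥-elim (v≢w v≡w)
  near-adj (inj₂ adj) _   = adj

  extend-clique : ∀ {L x} → IsClique G L → (∀ w → w ∈ L → Near G x w) →
    IsClique G (L ∪ ⁅ x ⁆)
  extend-clique {L} {x} clique near v w v∈ w∈ v≢w
    with x∈p∪q⁻ L ⁅ x ⁆ v∈ | x∈p∪q⁻ L ⁅ x ⁆ w∈
  ... | inj₁ v∈L | inj₁ w∈L = clique v w v∈L w∈L v≢w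
  ... | inj₂ v∈x | inj₁ w∈L with x∈⁅y⁆⇒x≡y x v∈x
  ...   | refl = near-adj (near w w∈L) v≢w
  extend-clique {L} {x} clique near v w v∈ w∈ v≢w | inj₁ v∈L | inj₂ w∈x with x∈⁅y⁆⇒x≡y x w∈x
  ...   | refl = Graph.sym G (near-adj (near v v∈L) (v≢w ∘ ≡.sym))
  extend-clique {L} {x} clique near v w v∈ w∈ v≢w | inj₂ v∈x | inj₂ w∈x =
    ⊥-elim (v≢w (trans (x∈⁅y⁆⇒x≡y x v∈x) (≡.sym (x∈⁅y⁆⇒x≡y x w∈x))))


  -- A maximal clique absorbs every vertex near all corners of one of its
  -- triangles: adding the vertex keeps a clique, by triangle-closedness.
  absorb : ∀ {L a b c x} → IsMaximalClique G L → a ∈ L → b ∈ L → c ∈ L →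
    Adj G a b → Adj G a c → Adj G b c → NearAll G x a b c → x ∈ L
  absorb {L} {x = x} (clique , maximal) a∈L b∈L c∈L ab ac bc near-x =
    subst (x ∈_) (maximal (L ∪ ⁅ x ⁆) (extend-clique clique near) (p⊆p∪q ⁅ x ⁆))
      (x∈p∪q⁺ (inj₂ (x∈⁅x⁆ x)))
    where
    near : ∀ w → w ∈ L → Near G x w
    near w w∈L = closed ab ac bc near-x
      (clique-near clique w∈L a∈L , clique-near clique w∈L b∈L , clique-near clique w∈L c∈L)

  shared-triangle⇒⊆ : ∀ {L L′ a b c} → IsClique G L → IsMaximalClique G L′ →
    a ∈ L ∩ L′ → b ∈ L ∩ L′ → c ∈ L ∩ L′ → a ≢ b → a ≢ c → b ≢ c → L ⊆ L′
  shared-triangle⇒⊆ {L} {L′} clique max′ a∈ b∈ c∈ a≢b a≢c b≢c {v} v∈L =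
    absorb max′ (in-L′ a∈) (in-L′ b∈) (in-L′ c∈)
      (adj′ a∈ b∈ a≢b) (adj′ a∈ c∈ a≢c) (adj′ b∈ c∈ b≢c)
      (near a∈ , near b∈ , near c∈)
    where
    in-L′ : ∀ {u} → u ∈ L ∩ L′ → u ∈ L′
    in-L′ = proj₂ ∘ x∈p∩q⁻ L L′
    adj′ : ∀ {u w} → u ∈ L ∩ L′ → w ∈ L ∩ L′ → u ≢ w → Adj G u w
    adj′ u∈ w∈ = proj₁ max′ _ _ (in-L′ u∈) (in-L′ w∈)
    near : ∀ {u} → u ∈ L ∩ L′ → Near G v u
    near u∈ = clique-near clique v∈L (proj₁ (x∈p∩q⁻ L L′ u∈))

  at-most-two-shared : ∀ {L L′} → IsMaximalClique G L → IsMaximalClique G L′ → L ≢ L′ →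
    ∣ L ∩ L′ ∣ ≤ 2
  at-most-two-shared {L} {L′} max max′ L≢L′ with ∣ L ∩ L′ ∣ ≤? 2
  ... | yes ≤2 = ≤2
  ... | no  ≰2 with three-members (L ∩ L′) (≰⇒> ≰2)
  ...   | a , b , c , a∈ , b∈ , c∈ , a≢b , a≢c , b≢c = ⊥-elim (L≢L′ (⊆-antisym
          (shared-triangle⇒⊆ (proj₁ max) max′ a∈ b∈ c∈ a≢b a≢c b≢c)
          (shared-triangle⇒⊆ (proj₁ max′) max (swap a∈) (swap b∈) (swap c∈) a≢b a≢c b≢c)))
    where
    swap : ∀ {u} → u ∈ L ∩ L′ → u ∈ L′ ∩ L
    swap = subst (_ ∈_) (∩-comm L L′)

  -- (2) If they share two vertices, there is no edge between their private parts:
  -- a vertex of L adjacent to w ∈ L′ would be absorbed into L′.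
  two-shared⇒no-edge : ∀ {L L′} → IsMaximalClique G L → IsMaximalClique G L′ →
    ∣ L ∩ L′ ∣ ≡ 2 → ∀ v w → v ∈ L → v ∉ L′ → w ∈ L′ → w ∉ L → ¬ Adj G v w
  two-shared⇒no-edge {L} {L′} (clique , _) max′ two v w v∈L v∉L′ w∈L′ w∉L vw
    with two-members (L ∩ L′) (≤-reflexive (≡.sym two))
  ... | a , b , a∈ , b∈ , a≢b = v∉L′ (absorb max′ a∈L′ b∈L′ w∈L′
          (proj₁ max′ a b a∈L′ b∈L′ a≢b)
          (proj₁ max′ a w a∈L′ w∈L′ (∈∉⇒≢ a∈L w∉L))
          (proj₁ max′ b w b∈L′ w∈L′ (∈∉⇒≢ b∈L w∉L))
          (clique-near clique v∈L a∈L , clique-near clique v∈L b∈L , inj₂ vw))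
    where
    a∈L : a ∈ L
    a∈L = proj₁ (x∈p∩q⁻ L L′ a∈)
    a∈L′ : a ∈ L′
    a∈L′ = proj₂ (x∈p∩q⁻ L L′ a∈)
    b∈L : b ∈ L
    b∈L = proj₁ (x∈p∩q⁻ L L′ b∈)
    b∈L′ : b ∈ L′
    b∈L′ = proj₂ (x∈p∩q⁻ L L′ b∈)

  -- (3) If they share one vertex a, a private vertex of L has at most one
  -- neighbour among the private vertices of L′: two of them would form a
  -- triangle with a that absorbs it into L′.
  one-shared⇒one-neighbour : ∀ {L L′} → IsMaximalClique G L → IsMaximalClique G L′ →
    ∣ L ∩ L′ ∣ ≡ 1 → ∀ v w₁ w₂ → v ∈ L → v ∉ L′ → w₁ ∈ L′ → w₁ ∉ L → w₂ ∈ L′ → w₂ ∉ L →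
    Adj G v w₁ → Adj G v w₂ → w₁ ≡ w₂
  one-shared⇒one-neighbour {L} {L′} (clique , _) max′ one v w₁ w₂
    v∈L v∉L′ w₁∈L′ w₁∉L w₂∈L′ w₂∉L vw₁ vw₂ with w₁ ≟ w₂
  ... | yes w₁≡w₂ = w₁≡w₂
  ... | no  w₁≢w₂ with some-member (L ∩ L′) (≤-reflexive (≡.sym one))
  ...   | a , a∈ = ⊥-elim (v∉L′ (absorb max′ a∈L′ w₁∈L′ w₂∈L′
          (proj₁ max′ a w₁ a∈L′ w₁∈L′ (∈∉⇒≢ a∈L w₁∉L))
          (proj₁ max′ a w₂ a∈L′ w₂∈L′ (∈∉⇒≢ a∈L w₂∉L))
          (proj₁ max′ w₁ w₂ w₁∈L′ w₂∈L′ w₁≢w₂)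
          (clique-near clique v∈L a∈L , inj₂ vw₁ , inj₂ vw₂)))
    where
    a∈L : a ∈ L
    a∈L = proj₁ (x∈p∩q⁻ L L′ a∈)
    a∈L′ : a ∈ L′
    a∈L′ = proj₂ (x∈p∩q⁻ L L′ a∈)

proposition2 : ∀ {N : ℕ} (G : Graph N) → IsJIS G →
    ∀ (L L′ : Subset N) → IsMaximalClique G L → IsMaximalClique G L′ → L ≢ L′ →
      (∣ L ∩ L′ ∣ ≤ 2)
    × (∣ L ∩ L′ ∣ ≡ 2 → ∀ v w → v ∈ L → v ∉ L′ → w ∈ L′ → w ∉ L → ¬ Adj G v w)
    × (∣ L ∩ L′ ∣ ≡ 1 →
         (∀ v w₁ w₂ → v ∈ L → v ∉ L′ → w₁ ∈ L′ → w₁ ∉ L → w₂ ∈ L′ → w₂ ∉ L →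
            Adj G v w₁ → Adj G v w₂ → w₁ ≡ w₂)
       × (∀ v w₁ w₂ → v ∈ L′ → v ∉ L → w₁ ∈ L → w₁ ∉ L′ → w₂ ∈ L → w₂ ∉ L′ →
            Adj G v w₁ → Adj G v w₂ → w₁ ≡ w₂))
proposition2 G jis L L′ max max′ L≢L′ =
    at-most-two-shared max max′ L≢L′
  , two-shared⇒no-edge max max′
  , λ one → one-shared⇒one-neighbour max max′ one
          , one-shared⇒one-neighbour max′ max (trans (cong ∣_∣ (∩-comm L′ L)) one)
  where open MaximalCliques G (jis⇒triangle-closed G jis)
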